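{- Let $m,n$ be distinct positive integers and $\ell=\gcd(m,n)$. Then in $\mathbb{Q}((T))$, $$\mathbf{B}(mT)\mathbf{B}(nT)=\mathbf{B}^2(\ell T)+mT\,\mathbf{B}(nT)\,g_{n,m}(e^T)+nT\,\mathbf{B}(mT)\,g_{m,n}(e^T).$$
   Context: Let $e^T=\sum_{i\ge 0}T^i/i!\in\mathbb{Q}[[T]]$ and $\mathbf{B}=\mathbf{B}(T)=T/(e^T-1)\in\mathbb{Q}[[T]]$; for $b\in\mathbb{Q}$, $\mathbf{B}(bT)$ denotes the power series obtained by substituting $bT$ for $T$, and $\mathbf{B}^k(bT)=(\mathbf{B}(bT))^k$. For a polynomial $g\in\mathbb{Q}[X]$, $g(e^T)$ denotes the power series obtained by substituting $e^T$ for $X$. Polynomials $g_{m,n}$ are defined as follows. For distinct positive integers $m,n$ with $\gcd(m,n)=1$, $g_{m,n}\in\mathbb{Q}[X]$ is the polynomial of degree less than $m-1$ (so $g_{1,n}=0$), and $g_{n,m}$ the polynomial of degree less than $n-1$, such that $$\frac{1}{(X-1)(1+X+\cdots+X^{m-1})(1+X+\cdots+X^{n-1})}=\frac{1}{mn(X-1)}+\frac{g_{n,m}}{1+X+\cdots+X^{n-1}}+\frac{g_{m,n}}{1+X+\cdots+X^{m-1}}.$$ For general distinct positive $m,n$ with $\ell=\gcd(m,n)$, set $g_{n,m}=g_{n/\ell,m/\ell}(X^\ell)$ and $g_{m,n}=g_{m/\ell,n/\ell}(X^\ell)$. -}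

module Defs where

open import Data.Nat as ℕ using (ℕ; zero; suc; _∸_)
open import Data.Integer using (+_)
open import Data.Rational using (ℚ; 0ℚ; 1ℚ; _+_; _*_; -_; _-_; _/_)
open import Data.List using (List; []; _∷_)
open import Data.Bool using (if_then_else_)
open import Relation.Nullary.Decidable using (⌊_⌋)
open import Relation.Binary.PropositionalEquality using (_≡_)

PS : Set
PS = ℕ → ℚ

infix 4 _≈ₚ_
_≈ₚ_ : PS → PS → Set
f ≈ₚ g = ∀ k → f k ≡ g k

sumTo : ℕ → (ℕ → ℚ) → ℚ
sumTo zero    f = f 0
sumTo (suc k) f = sumTo k f + f (suc k)

ℕ→ℚ : ℕ → ℚ
ℕ→ℚ n = (+ n) / 1

_^ℚ_ : ℚ → ℕ → ℚ
q ^ℚ zero  = 1ℚ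
q ^ℚ suc k = q * (q ^ℚ k)

infixl 6 _⊕_ _⊖_
infixl 7 _⊗_

constPS : ℚ → PS
constPS c zero    = c
constPS c (suc _) = 0ℚ

_⊕_ : PS → PS → PS
(f ⊕ g) k = f k + g k

_⊖_ : PS → PS → PS
(f ⊖ g) k = f k - g k

_⊗_ : PS → PS → PS
(f ⊗ g) k = sumTo k (λ j → f j * g (k ∸ j))

_·ₚ_ : ℚ → PS → PS
(c ·ₚ f) k = c * f k

powPS : PS → ℕ → PS
powPS f zero    = constPS 1ℚ
powPS f (suc k) = f ⊗ powPS f k

Tₚ : PS
Tₚ zero          = 0ℚ
Tₚ (suc zero)    = 1ℚ
Tₚ (suc (suc _)) = 0ℚ

-- substitution T ↦ bT :  f(bT) has coefficients b^k f_k
substScale : ℚ → PS → PS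
substScale b f k = (b ^ℚ k) * f k

invFact : ℕ → ℚ
invFact zero    = 1ℚ
invFact (suc k) = invFact k * ((+ 1) / suc k)

expT : PS
expT k = invFact k

-- (e^T - 1)/T = Σ T^i/(i+1)!   (coefficients of e^T - 1 shifted down by one)
expM1overT : PS
expM1overT k = invFact (suc k)

-- Multiplicative inverse of a power series with constant term 1:
-- b_0 = 1, b_{k+1} = - Σ_{j=0}^{k} f_{j+1} b_{k-j}.
-- invAux f k is correct on indices ≤ k.
invAux : PS → ℕ → PS
invAux f zero    = λ _ → 1ℚ
invAux f (suc k) i =
  if ⌊ i ℕ.≤? k ⌋ then invAux f k i
  else - sumTo k (λ j → f (suc j) * invAux f k (k ∸ j))

inv1 : PS → PS
inv1 f k = invAux f k k

-- B(T) = T/(e^T - 1) = ((e^T - 1)/T)^{-1}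
Bₚ : PS
Bₚ = inv1 expM1overT

-- Polynomials over ℚ as coefficient lists (constant term first).
Poly : Set
Poly = List ℚ

polyCoeff : Poly → PS
polyCoeff []       k       = 0ℚ
polyCoeff (c ∷ cs) zero    = c
polyCoeff (c ∷ cs) (suc k) = polyCoeff cs k

evalPS : Poly → PS → PS
evalPS []       s = constPS 0ℚ
evalPS (c ∷ cs) s = constPS c ⊕ s ⊗ evalPS cs s

Φ : ℕ → PS
Φ m k = if ⌊ k ℕ.<? m ⌋ then 1ℚ else 0ℚ

Xm1 : PS
Xm1 = Tₚ ⊖ constPS 1ℚ

-- Partial fraction identity (coprime case) defining g_{m,n} (paired with Φ_m)
-- and g_{n,m} (paired with Φ_n):
--   1/((X-1)Φ_m Φ_n) = 1/(mn(X-1)) + g_{n,m}/Φ_n + g_{m,n}/Φ_m,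
-- stated after multiplying through by mn(X-1)Φ_m Φ_n, as an identity in ℚ[X]:
--   mn = Φ_m Φ_n + mn (X-1) Φ_m g_{n,m} + mn (X-1) Φ_n g_{m,n}.
PartialFrac : ℕ → ℕ → Poly → Poly → Set
PartialFrac m n gmn gnm =
  constPS (ℕ→ℚ (m ℕ.* n))
    ≈ₚ Φ m ⊗ Φ n
       ⊕ ℕ→ℚ (m ℕ.* n) ·ₚ (Xm1 ⊗ Φ m ⊗ polyCoeff gnm)
       ⊕ ℕ→ℚ (m ℕ.* n) ·ₚ (Xm1 ⊗ Φ n ⊗ polyCoeff gmn)

module Submission where

-- The identity  B(mT) B(nT) = B²(ℓT) + mT B(nT) g_{n,m}(e^T) + nT B(mT) g_{m,n}(e^T)
-- is obtained by evaluating the partial-fraction identity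
--   m₀n₀ = Φ_{m₀}Φ_{n₀} + m₀n₀ (X-1)Φ_{m₀} q + m₀n₀ (X-1)Φ_{n₀} p      (m = m₀ℓ, n = n₀ℓ)
-- at X = e^{ℓT} and clearing denominators.  Three facts about power series make this work:
--   * B(cT) (e^{cT} - 1) = cT, because B = T/(e^T - 1) is the inverse of (e^T - 1)/T;
--   * (e^T)^ℓ = e^{ℓT}, proved through the derivative: both sides solve f' = ℓ f, f(0) = 1;
--   * (X - 1) Φ_k(X) = X^k - 1, so at X = e^{ℓT} we get (X-1)Φ_{m₀}(X) = e^{mT} - 1.
-- Multiplying the evaluated identity by B(mT) B(nT) B(ℓT)² (X-1)² turns every factor into a
-- multiple of T; the result is the theorem multiplied by the unit mn and by T², both cancellable.

open import Defs
open import Data.Nat as ℕ using (ℕ; zero; suc; _*_; _∸_; _≤_; z≤n; s≤s; NonZero)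
import Data.Nat.Properties as ℕP
open import Data.Nat.GCD using (gcd)
open import Data.Integer as ℤ using (+_)
import Data.Integer.Properties as ℤP
import Data.Integer.Tactic.RingSolver as ℤSolver
open import Data.Rational as ℚ using (ℚ; 0ℚ; 1ℚ; toℚᵘ)
  renaming (_+_ to _+ℚ_; _*_ to _*ℚ_; -_ to -ℚ_; _-_ to _-ℚ_)
import Data.Rational.Properties as ℚP
open import Data.Rational.Unnormalised as ℚᵘ using (mkℚᵘ; *≡*) renaming (_≃_ to _≃ᵘ_)
import Data.Rational.Unnormalised.Properties as ℚᵘP
open import Data.List using ([]; _∷_; length; replicate)
open import Data.Bool using (if_then_else_)
open import Data.Maybe using (Maybe; just; nothing)
open import Data.Product using (_,_)
open import Data.Sum using (inj₁; inj₂)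
open import Data.Empty using (⊥-elim)
open import Relation.Nullary using (¬_)
open import Relation.Nullary.Decidable using (Dec; yes; no; ⌊_⌋)
open import Relation.Binary.PropositionalEquality
  using (_≡_; _≢_; refl; sym; trans; cong; cong₂; module ≡-Reasoning)
open import Level using (0ℓ)
open import Algebra.Bundles using (CommutativeRing)
import Algebra.Solver.Ring
import Relation.Binary.Reasoning.Setoid
import Algebra.Solver.Ring.NaturalCoefficients.Default
import Algebra.Properties.Semiring.Exp
import Algebra.Solver.Ring.AlmostCommutativeRing as ACR
open import Tactic.RingSolver.Core.AlmostCommutativeRing using (AlmostCommutativeRing; fromCommutativeRing)
open import Tactic.RingSolver using (solve-∀)

-- Read b_m, b_n, b_l as B(mT), B(nT),
-- B(ℓT), a as X - 1, φ_m, φ_n as Φ_{m₀}(X), Φ_{n₀}(X), μ, ν, l as m₀, n₀, ℓ and t as T: the hypotheses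
-- say b_k·(X^k - 1) = kT and give the partial-fraction identity; the conclusion is the theorem times mn T².
module ClearingDenominators {r₁ r₂} (R : CommutativeRing r₁ r₂) where
  open CommutativeRing R using (_≈_; 1#; setoid; *-cong; +-cong; *-assoc; *-identityˡ)
    renaming (_+_ to _+ᴿ_; _*_ to _*ᴿ_; refl to ≈ᴿ-refl; sym to ≈ᴿ-sym)
  open Relation.Binary.Reasoning.Setoid setoid
  open Algebra.Solver.Ring.NaturalCoefficients.Default (CommutativeRing.commutativeSemiring R)
    using (solve; _:=_; _:+_; _:*_)

  cancel-unit : ∀ {u v x y} → v *ᴿ u ≈ 1# → u *ᴿ x ≈ u *ᴿ y → x ≈ y
  cancel-unit {u} {v} {x} {y} vu≈1 ux≈uy = begin
    x                ≈⟨ ≈ᴿ-sym (*-identityˡ x) ⟩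
    1# *ᴿ x          ≈⟨ *-cong (≈ᴿ-sym vu≈1) ≈ᴿ-refl ⟩
    (v *ᴿ u) *ᴿ x    ≈⟨ *-assoc v u x ⟩
    v *ᴿ (u *ᴿ x)    ≈⟨ *-cong ≈ᴿ-refl ux≈uy ⟩
    v *ᴿ (u *ᴿ y)    ≈⟨ ≈ᴿ-sym (*-assoc v u y) ⟩
    (v *ᴿ u) *ᴿ y    ≈⟨ *-cong vu≈1 ≈ᴿ-refl ⟩
    1# *ᴿ y          ≈⟨ *-identityˡ y ⟩
    y                ∎

  scalars-first : ∀ μ ν l t bm bn →
    ((μ *ᴿ l) *ᴿ (ν *ᴿ l)) *ᴿ (t *ᴿ (t *ᴿ (bm *ᴿ bn))) ≈ (μ *ᴿ ν) *ᴿ ((l *ᴿ t) *ᴿ (l *ᴿ t)) *ᴿ (bm *ᴿ bn)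
  scalars-first = solve 6 (λ μ ν l t bm bn →
    ((μ :* l) :* (ν :* l)) :* (t :* (t :* (bm :* bn))) := (μ :* ν) :* ((l :* t) :* (l :* t)) :* (bm :* bn)) ≈ᴿ-refl
  distribute-clearing : ∀ bm bn bl a φm φn p q μ ν →
    (φm *ᴿ φn +ᴿ (μ *ᴿ ν) *ᴿ (a *ᴿ φm *ᴿ q) +ᴿ (μ *ᴿ ν) *ᴿ (a *ᴿ φn *ᴿ p)) *ᴿ ((bl *ᴿ a) *ᴿ (bl *ᴿ a)) *ᴿ (bm *ᴿ bn)
    ≈ bm *ᴿ (a *ᴿ φm) *ᴿ (bn *ᴿ (a *ᴿ φn)) *ᴿ (bl *ᴿ bl)
      +ᴿ (μ *ᴿ ν) *ᴿ (bm *ᴿ (a *ᴿ φm) *ᴿ (bn *ᴿ q) *ᴿ ((bl *ᴿ a) *ᴿ (bl *ᴿ a)))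
      +ᴿ (μ *ᴿ ν) *ᴿ (bn *ᴿ (a *ᴿ φn) *ᴿ (bm *ᴿ p) *ᴿ ((bl *ᴿ a) *ᴿ (bl *ᴿ a)))
  distribute-clearing = solve 10 (λ bm bn bl a φm φn p q μ ν →
    (φm :* φn :+ (μ :* ν) :* (a :* φm :* q) :+ (μ :* ν) :* (a :* φn :* p)) :* ((bl :* a) :* (bl :* a)) :* (bm :* bn)
    := bm :* (a :* φm) :* (bn :* (a :* φn)) :* (bl :* bl)
       :+ (μ :* ν) :* (bm :* (a :* φm) :* (bn :* q) :* ((bl :* a) :* (bl :* a)))
       :+ (μ :* ν) :* (bn :* (a :* φn) :* (bm :* p) :* ((bl :* a) :* (bl :* a)))) ≈ᴿ-refl
  factor-out-mnT² : ∀ μ ν l t bm bn bl q p →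
    (μ *ᴿ l) *ᴿ t *ᴿ ((ν *ᴿ l) *ᴿ t) *ᴿ (bl *ᴿ bl)
      +ᴿ (μ *ᴿ ν) *ᴿ ((μ *ᴿ l) *ᴿ t *ᴿ (bn *ᴿ q) *ᴿ ((l *ᴿ t) *ᴿ (l *ᴿ t)))
      +ᴿ (μ *ᴿ ν) *ᴿ ((ν *ᴿ l) *ᴿ t *ᴿ (bm *ᴿ p) *ᴿ ((l *ᴿ t) *ᴿ (l *ᴿ t)))
    ≈ ((μ *ᴿ l) *ᴿ (ν *ᴿ l)) *ᴿ (t *ᴿ (t *ᴿ (bl *ᴿ bl +ᴿ (μ *ᴿ l) *ᴿ (t *ᴿ bn *ᴿ q) +ᴿ (ν *ᴿ l) *ᴿ (t *ᴿ bm *ᴿ p))))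
  factor-out-mnT² = solve 9 (λ μ ν l t bm bn bl q p →
    (μ :* l) :* t :* ((ν :* l) :* t) :* (bl :* bl)
      :+ (μ :* ν) :* ((μ :* l) :* t :* (bn :* q) :* ((l :* t) :* (l :* t)))
      :+ (μ :* ν) :* ((ν :* l) :* t :* (bm :* p) :* ((l :* t) :* (l :* t)))
    := ((μ :* l) :* (ν :* l)) :* (t :* (t :* (bl :* bl :+ (μ :* l) :* (t :* bn :* q) :+ (ν :* l) :* (t :* bm :* p))))) ≈ᴿ-refl

  -- Multiply the partial-fraction identity by b_m b_n b_l² a² and use the three hypotheses
  -- b_m·(a φ_m) = μl t,  b_n·(a φ_n) = νl t,  b_l·a = l t  to turn every factor into a multiple of t.
  clear-denominators : ∀ {μ ν l t bm bn bl a φm φn p q} →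
    bm *ᴿ (a *ᴿ φm) ≈ (μ *ᴿ l) *ᴿ t →
    bn *ᴿ (a *ᴿ φn) ≈ (ν *ᴿ l) *ᴿ t →
    bl *ᴿ a ≈ l *ᴿ t →
    μ *ᴿ ν ≈ φm *ᴿ φn +ᴿ (μ *ᴿ ν) *ᴿ (a *ᴿ φm *ᴿ q) +ᴿ (μ *ᴿ ν) *ᴿ (a *ᴿ φn *ᴿ p) →
    ((μ *ᴿ l) *ᴿ (ν *ᴿ l)) *ᴿ (t *ᴿ (t *ᴿ (bm *ᴿ bn)))
      ≈ ((μ *ᴿ l) *ᴿ (ν *ᴿ l)) *ᴿ (t *ᴿ (t *ᴿ (bl *ᴿ bl +ᴿ (μ *ᴿ l) *ᴿ (t *ᴿ bn *ᴿ q) +ᴿ (ν *ᴿ l) *ᴿ (t *ᴿ bm *ᴿ p))))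
  clear-denominators {μ} {ν} {l} {t} {bm} {bn} {bl} {a} {φm} {φn} {p} {q} hm hn hl pf = begin
    ((μ *ᴿ l) *ᴿ (ν *ᴿ l)) *ᴿ (t *ᴿ (t *ᴿ (bm *ᴿ bn)))
      ≈⟨ scalars-first μ ν l t bm bn ⟩
    (μ *ᴿ ν) *ᴿ ((l *ᴿ t) *ᴿ (l *ᴿ t)) *ᴿ (bm *ᴿ bn)
      ≈⟨ *-cong (*-cong ≈ᴿ-refl (*-cong (≈ᴿ-sym hl) (≈ᴿ-sym hl))) ≈ᴿ-refl ⟩
    (μ *ᴿ ν) *ᴿ ((bl *ᴿ a) *ᴿ (bl *ᴿ a)) *ᴿ (bm *ᴿ bn)
      ≈⟨ *-cong (*-cong pf ≈ᴿ-refl) ≈ᴿ-refl ⟩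
    (φm *ᴿ φn +ᴿ (μ *ᴿ ν) *ᴿ (a *ᴿ φm *ᴿ q) +ᴿ (μ *ᴿ ν) *ᴿ (a *ᴿ φn *ᴿ p)) *ᴿ ((bl *ᴿ a) *ᴿ (bl *ᴿ a)) *ᴿ (bm *ᴿ bn)
      ≈⟨ distribute-clearing bm bn bl a φm φn p q μ ν ⟩
    bm *ᴿ (a *ᴿ φm) *ᴿ (bn *ᴿ (a *ᴿ φn)) *ᴿ (bl *ᴿ bl)
      +ᴿ (μ *ᴿ ν) *ᴿ (bm *ᴿ (a *ᴿ φm) *ᴿ (bn *ᴿ q) *ᴿ ((bl *ᴿ a) *ᴿ (bl *ᴿ a)))
      +ᴿ (μ *ᴿ ν) *ᴿ (bn *ᴿ (a *ᴿ φn) *ᴿ (bm *ᴿ p) *ᴿ ((bl *ᴿ a) *ᴿ (bl *ᴿ a)))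
      ≈⟨ +-cong (+-cong (*-cong (*-cong hm hn) ≈ᴿ-refl)
                        (*-cong ≈ᴿ-refl (*-cong (*-cong hm ≈ᴿ-refl) (*-cong hl hl))))
                (*-cong ≈ᴿ-refl (*-cong (*-cong hn ≈ᴿ-refl) (*-cong hl hl))) ⟩
    (μ *ᴿ l) *ᴿ t *ᴿ ((ν *ᴿ l) *ᴿ t) *ᴿ (bl *ᴿ bl)
      +ᴿ (μ *ᴿ ν) *ᴿ ((μ *ᴿ l) *ᴿ t *ᴿ (bn *ᴿ q) *ᴿ ((l *ᴿ t) *ᴿ (l *ᴿ t)))
      +ᴿ (μ *ᴿ ν) *ᴿ ((ν *ᴿ l) *ᴿ t *ᴿ (bm *ᴿ p) *ᴿ ((l *ᴿ t) *ᴿ (l *ᴿ t)))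
      ≈⟨ factor-out-mnT² μ ν l t bm bn bl q p ⟩
    ((μ *ᴿ l) *ᴿ (ν *ᴿ l)) *ᴿ (t *ᴿ (t *ᴿ (bl *ᴿ bl +ᴿ (μ *ᴿ l) *ᴿ (t *ᴿ bn *ᴿ q) +ᴿ (ν *ᴿ l) *ᴿ (t *ᴿ bm *ᴿ p)))) ∎

ℚring : AlmostCommutativeRing 0ℓ 0ℓ
ℚring = fromCommutativeRing ℚP.+-*-commutativeRing (λ _ → nothing)

toℚᵘ-ℕ→ℚ : ∀ n → toℚᵘ (ℕ→ℚ n) ≃ᵘ mkℚᵘ (+ n) 0
toℚᵘ-ℕ→ℚ n = ℚP.toℚᵘ-fromℚᵘ (mkℚᵘ (+ n) 0)

ℕ→ℚ-+ : ∀ a b → ℕ→ℚ (a ℕ.+ b) ≡ ℕ→ℚ a +ℚ ℕ→ℚ b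
ℕ→ℚ-+ a b = ℚP.toℚᵘ-injective (ℚᵘP.≃-trans (toℚᵘ-ℕ→ℚ (a ℕ.+ b)) (ℚᵘP.≃-trans fractions
  (ℚᵘP.≃-sym (ℚᵘP.≃-trans (ℚP.toℚᵘ-homo-+ (ℕ→ℚ a) (ℕ→ℚ b)) (ℚᵘP.+-cong (toℚᵘ-ℕ→ℚ a) (toℚᵘ-ℕ→ℚ b))))))
  where
  cross : ∀ x y → (x ℤ.+ y) ℤ.* + 1 ≡ (x ℤ.* + 1 ℤ.+ y ℤ.* + 1) ℤ.* + 1
  cross = ℤSolver.solve-∀
  fractions : mkℚᵘ (+ (a ℕ.+ b)) 0 ≃ᵘ (mkℚᵘ (+ a) 0 ℚᵘ.+ mkℚᵘ (+ b) 0)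
  fractions = *≡* (cross (+ a) (+ b))

ℕ→ℚ-* : ∀ a b → ℕ→ℚ (a * b) ≡ ℕ→ℚ a *ℚ ℕ→ℚ b
ℕ→ℚ-* a b = ℚP.toℚᵘ-injective (ℚᵘP.≃-trans (toℚᵘ-ℕ→ℚ (a * b)) (ℚᵘP.≃-trans fractions
  (ℚᵘP.≃-sym (ℚᵘP.≃-trans (ℚP.toℚᵘ-homo-* (ℕ→ℚ a) (ℕ→ℚ b)) (ℚᵘP.*-cong (toℚᵘ-ℕ→ℚ a) (toℚᵘ-ℕ→ℚ b))))))
  where
  fractions : mkℚᵘ (+ (a * b)) 0 ≃ᵘ (mkℚᵘ (+ a) 0 ℚᵘ.* mkℚᵘ (+ b) 0)
  fractions = *≡* (cong (ℤ._* + 1) (ℤP.pos-* a b))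

recip : ℕ → ℚ
recip k = (+ 1) ℚ./ suc k

ℕ→ℚ-inverse : ∀ k → ℕ→ℚ (suc k) *ℚ recip k ≡ 1ℚ
ℕ→ℚ-inverse k = ℚP.toℚᵘ-injective (ℚᵘP.≃-trans (ℚP.toℚᵘ-homo-* (ℕ→ℚ (suc k)) (recip k))
  (ℚᵘP.≃-trans (ℚᵘP.*-cong (toℚᵘ-ℕ→ℚ (suc k)) (ℚP.toℚᵘ-fromℚᵘ (mkℚᵘ (+ 1) k))) (*≡* cross)))
  where
  unit-fraction : ∀ x → (x ℤ.* + 1) ℤ.* + 1 ≡ + 1 ℤ.* x
  unit-fraction = ℤSolver.solve-∀
  cross : (+ suc k ℤ.* + 1) ℤ.* + 1 ≡ + 1 ℤ.* + (1 ℕ.* suc k)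
  cross = trans (unit-fraction (+ suc k)) (cong (λ z → + 1 ℤ.* + z) (sym (ℕP.*-identityˡ (suc k))))

sumTo-cong : ∀ k {f g : ℕ → ℚ} → (∀ j → j ≤ k → f j ≡ g j) → sumTo k f ≡ sumTo k g
sumTo-cong zero    f≡g = f≡g 0 z≤n
sumTo-cong (suc k) f≡g =
  cong₂ _+ℚ_ (sumTo-cong k (λ j j≤k → f≡g j (ℕP.m≤n⇒m≤1+n j≤k))) (f≡g (suc k) ℕP.≤-refl)

sumTo-zero : ∀ k {f : ℕ → ℚ} → (∀ j → j ≤ k → f j ≡ 0ℚ) → sumTo k f ≡ 0ℚ
sumTo-zero zero    f≡0 = f≡0 0 z≤n
sumTo-zero (suc k) f≡0 =
  cong₂ _+ℚ_ (sumTo-zero k (λ j j≤k → f≡0 j (ℕP.m≤n⇒m≤1+n j≤k))) (f≡0 (suc k) ℕP.≤-refl)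

sumTo-+ : ∀ k (f g : ℕ → ℚ) → sumTo k (λ j → f j +ℚ g j) ≡ sumTo k f +ℚ sumTo k g
sumTo-+ zero    f g = refl
sumTo-+ (suc k) f g = trans (cong (_+ℚ (f (suc k) +ℚ g (suc k))) (sumTo-+ k f g))
                            (interchange (sumTo k f) (sumTo k g) (f (suc k)) (g (suc k)))
  where
  interchange : ∀ a b c d → (a +ℚ b) +ℚ (c +ℚ d) ≡ (a +ℚ c) +ℚ (b +ℚ d)
  interchange = solve-∀ ℚring

sumTo-*ˡ : ∀ k (c : ℚ) (f : ℕ → ℚ) → sumTo k (λ j → c *ℚ f j) ≡ c *ℚ sumTo k f
sumTo-*ˡ zero    c f = refl
sumTo-*ˡ (suc k) c f = trans (cong (_+ℚ (c *ℚ f (suc k))) (sumTo-*ˡ k c f))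
                             (sym (ℚP.*-distribˡ-+ c (sumTo k f) (f (suc k))))

sumTo-head : ∀ k (f : ℕ → ℚ) → sumTo (suc k) f ≡ f 0 +ℚ sumTo k (λ j → f (suc j))
sumTo-head zero    f = refl
sumTo-head (suc k) f = trans (cong (_+ℚ f (suc (suc k))) (sumTo-head k f)) (ℚP.+-assoc (f 0) _ _)

sumTo-reverse : ∀ k (f : ℕ → ℚ) → sumTo k f ≡ sumTo k (λ j → f (k ∸ j))
sumTo-reverse zero    f = refl
sumTo-reverse (suc k) f = begin
  sumTo (suc k) f                              ≡⟨ sumTo-head k f ⟩
  f 0 +ℚ sumTo k (λ j → f (suc j))             ≡⟨ ℚP.+-comm (f 0) _ ⟩
  sumTo k (λ j → f (suc j)) +ℚ f 0             ≡⟨ cong (_+ℚ f 0) (sumTo-reverse k (λ j → f (suc j))) ⟩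
  sumTo k (λ j → f (suc (k ∸ j))) +ℚ f 0
    ≡⟨ cong₂ _+ℚ_ (sumTo-cong k (λ j j≤k → cong f (sym (ℕP.+-∸-assoc 1 j≤k))))
                  (cong f (sym (ℕP.n∸n≡0 k))) ⟩
  sumTo (suc k) (λ j → f (suc k ∸ j))          ∎
  where open ≡-Reasoning

sumTo-exchange : ∀ k (F : ℕ → ℕ → ℚ) →
  sumTo k (λ i → sumTo i (λ j → F i j)) ≡ sumTo k (λ j → sumTo (k ∸ j) (λ t → F (j ℕ.+ t) j))
sumTo-exchange zero    F = refl
sumTo-exchange (suc k) F = begin
  sumTo k (λ i → sumTo i (F i)) +ℚ sumTo (suc k) (F (suc k))
    ≡⟨ cong (_+ℚ sumTo (suc k) (F (suc k))) (sumTo-exchange k F) ⟩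
  sumTo k column +ℚ (sumTo k (F (suc k)) +ℚ F (suc k) (suc k))
    ≡⟨ sym (ℚP.+-assoc (sumTo k column) _ _) ⟩
  (sumTo k column +ℚ sumTo k (F (suc k))) +ℚ F (suc k) (suc k)
    ≡⟨ cong (_+ℚ F (suc k) (suc k)) (sym (sumTo-+ k column (F (suc k)))) ⟩
  sumTo k (λ j → column j +ℚ F (suc k) j) +ℚ F (suc k) (suc k)
    ≡⟨ cong₂ _+ℚ_ (sumTo-cong k extend-column) (cong (λ z → F z (suc k)) (sym (ℕP.+-identityʳ (suc k)))) ⟩
  sumTo k column′ +ℚ F (suc k ℕ.+ 0) (suc k)
    ≡⟨ cong (λ z → sumTo k column′ +ℚ sumTo z (λ t → F (suc k ℕ.+ t) (suc k))) (sym (ℕP.n∸n≡0 k)) ⟩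
  sumTo (suc k) column′ ∎
  where
  open ≡-Reasoning
  column column′ : ℕ → ℚ
  column  j = sumTo (k ∸ j) (λ t → F (j ℕ.+ t) j)
  column′ j = sumTo (suc k ∸ j) (λ t → F (j ℕ.+ t) j)
  extend-column : ∀ j → j ≤ k → column j +ℚ F (suc k) j ≡ column′ j
  extend-column j j≤k = begin
    column j +ℚ F (suc k) j
      ≡⟨ cong (λ z → column j +ℚ F z j)
              (trans (cong suc (sym (ℕP.m+[n∸m]≡n j≤k))) (sym (ℕP.+-suc j (k ∸ j)))) ⟩
    sumTo (suc (k ∸ j)) (λ t → F (j ℕ.+ t) j)
      ≡⟨ cong (λ z → sumTo z (λ t → F (j ℕ.+ t) j)) (sym (ℕP.+-∸-assoc 1 j≤k)) ⟩
    column′ j ∎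

negPS : PS → PS
negPS f k = -ℚ f k

zeroPS onePS : PS
zeroPS _ = 0ℚ
onePS = constPS 1ℚ

≈-refl : ∀ {f : PS} → f ≈ₚ f
≈-refl k = refl

≈-sym : ∀ {f g : PS} → f ≈ₚ g → g ≈ₚ f
≈-sym f≈g k = sym (f≈g k)

≈-trans : ∀ {f g h : PS} → f ≈ₚ g → g ≈ₚ h → f ≈ₚ h
≈-trans f≈g g≈h k = trans (f≈g k) (g≈h k)

⊕-cong : ∀ {f f′ g g′} → f ≈ₚ f′ → g ≈ₚ g′ → f ⊕ g ≈ₚ f′ ⊕ g′
⊕-cong f≈f′ g≈g′ k = cong₂ _+ℚ_ (f≈f′ k) (g≈g′ k)

⊗-cong : ∀ {f f′ g g′} → f ≈ₚ f′ → g ≈ₚ g′ → f ⊗ g ≈ₚ f′ ⊗ g′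
⊗-cong f≈f′ g≈g′ k = sumTo-cong k (λ j _ → cong₂ _*ℚ_ (f≈f′ j) (g≈g′ (k ∸ j)))

-- Commutativity of the Cauchy product is the reversal of its defining sum.
⊗-comm : ∀ f g → f ⊗ g ≈ₚ g ⊗ f
⊗-comm f g k = trans (sumTo-reverse k _) (sumTo-cong k λ j j≤k →
  trans (cong (λ i → f (k ∸ j) *ℚ g i) (ℕP.m∸[m∸n]≡n j≤k)) (ℚP.*-comm (f (k ∸ j)) (g j)))

-- Associativity of the Cauchy product is the exchange of a triangular double sum.
⊗-assoc : ∀ f g h → (f ⊗ g) ⊗ h ≈ₚ f ⊗ (g ⊗ h)
⊗-assoc f g h k = begin
  sumTo k (λ i → sumTo i (λ j → f j *ℚ g (i ∸ j)) *ℚ h (k ∸ i))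
    ≡⟨ sumTo-cong k (λ i _ → distribute-right i) ⟩
  sumTo k (λ i → sumTo i (λ j → (f j *ℚ g (i ∸ j)) *ℚ h (k ∸ i)))
    ≡⟨ sumTo-exchange k (λ i j → (f j *ℚ g (i ∸ j)) *ℚ h (k ∸ i)) ⟩
  sumTo k (λ j → sumTo (k ∸ j) (λ t → (f j *ℚ g (j ℕ.+ t ∸ j)) *ℚ h (k ∸ (j ℕ.+ t))))
    ≡⟨ sumTo-cong k (λ j _ → trans (sumTo-cong (k ∸ j) (λ t _ → reindex j t)) (sumTo-*ˡ (k ∸ j) (f j) _)) ⟩
  sumTo k (λ j → f j *ℚ sumTo (k ∸ j) (λ t → g t *ℚ h (k ∸ j ∸ t))) ∎
  where
  open ≡-Reasoning
  distribute-right : ∀ i → sumTo i (λ j → f j *ℚ g (i ∸ j)) *ℚ h (k ∸ i)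
                         ≡ sumTo i (λ j → (f j *ℚ g (i ∸ j)) *ℚ h (k ∸ i))
  distribute-right i = trans (ℚP.*-comm _ (h (k ∸ i))) (trans (sym (sumTo-*ˡ i (h (k ∸ i)) _))
                             (sumTo-cong i (λ j _ → ℚP.*-comm (h (k ∸ i)) _)))
  reindex : ∀ j t → (f j *ℚ g (j ℕ.+ t ∸ j)) *ℚ h (k ∸ (j ℕ.+ t)) ≡ f j *ℚ (g t *ℚ h (k ∸ j ∸ t))
  reindex j t = trans (cong₂ (λ a b → (f j *ℚ g a) *ℚ h b) (ℕP.m+n∸m≡n j t) (sym (ℕP.∸-+-assoc k j t)))
                      (ℚP.*-assoc (f j) _ _)

⊗-distribˡ : ∀ f g h → f ⊗ (g ⊕ h) ≈ₚ (f ⊗ g) ⊕ (f ⊗ h)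
⊗-distribˡ f g h k = trans (sumTo-cong k (λ j _ → ℚP.*-distribˡ-+ (f j) _ _)) (sumTo-+ k _ _)

⊗-distribʳ : ∀ f g h → (g ⊕ h) ⊗ f ≈ₚ (g ⊗ f) ⊕ (h ⊗ f)
⊗-distribʳ f g h = ≈-trans (⊗-comm (g ⊕ h) f)
  (≈-trans (⊗-distribˡ f g h) (⊕-cong (⊗-comm f g) (⊗-comm f h)))

const⊗ : ∀ c f → constPS c ⊗ f ≈ₚ c ·ₚ f
const⊗ c f zero    = refl
const⊗ c f (suc k) = trans (sumTo-head k _)
  (trans (cong (c *ℚ f (suc k) +ℚ_) (sumTo-zero k (λ j _ → ℚP.*-zeroˡ (f (suc k ∸ suc j)))))
         (ℚP.+-identityʳ _))

⊗-identityˡ : ∀ f → onePS ⊗ f ≈ₚ f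
⊗-identityˡ f = ≈-trans (const⊗ 1ℚ f) (λ k → ℚP.*-identityˡ (f k))

⊗-identityʳ : ∀ f → f ⊗ onePS ≈ₚ f
⊗-identityʳ f = ≈-trans (⊗-comm f onePS) (⊗-identityˡ f)

PSring : CommutativeRing 0ℓ 0ℓ
PSring = record
  { Carrier = PS ; _≈_ = _≈ₚ_ ; _+_ = _⊕_ ; _*_ = _⊗_ ; -_ = negPS ; 0# = zeroPS ; 1# = onePS
  ; isCommutativeRing = record
    { isRing = record
      { +-isAbelianGroup = record
        { isGroup = record
          { isMonoid = record
            { isSemigroup = record
              { isMagma = record
                { isEquivalence = record { refl = ≈-refl ; sym = ≈-sym ; trans = ≈-trans }
                ; ∙-cong = ⊕-cong }
              ; assoc = λ f g h k → ℚP.+-assoc (f k) (g k) (h k) }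
            ; identity = (λ f k → ℚP.+-identityˡ (f k)) , (λ f k → ℚP.+-identityʳ (f k)) }
          ; inverse = (λ f k → ℚP.+-inverseˡ (f k)) , (λ f k → ℚP.+-inverseʳ (f k))
          ; ⁻¹-cong = λ f≈g k → cong -ℚ_ (f≈g k) }
        ; comm = λ f g k → ℚP.+-comm (f k) (g k) }
      ; *-cong = ⊗-cong
      ; *-assoc = ⊗-assoc
      ; *-identity = ⊗-identityˡ , ⊗-identityʳ
      ; distrib = ⊗-distribˡ , ⊗-distribʳ }
    ; *-comm = ⊗-comm } }

module PS-Reasoning = Relation.Binary.Reasoning.Setoid (CommutativeRing.setoid PSring)

-- The constant series form a copy of ℚ inside ℚ[[T]]; with this embedding the ring solver
-- normalises identities of power series with rational constants.
constPS-cong : ∀ {a b} → a ≡ b → constPS a ≈ₚ constPS b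
constPS-cong refl = ≈-refl

constPS-morphism : CommutativeRing.rawRing ℚP.+-*-commutativeRing ACR.-Raw-AlmostCommutative⟶
                   ACR.fromCommutativeRing PSring
constPS-morphism = record
  { ⟦_⟧    = constPS
  ; +-homo = λ a b → λ { zero → refl ; (suc k) → refl }
  ; *-homo = λ a b → ≈-sym (≈-trans (const⊗ a (constPS b)) λ { zero → refl ; (suc k) → ℚP.*-zeroʳ a })
  ; -‿homo = λ a → λ { zero → refl ; (suc k) → refl }
  ; 0-homo = λ { zero → refl ; (suc k) → refl }
  ; 1-homo = λ { zero → refl ; (suc k) → refl } }

constPS-equal? : ∀ a b → Maybe (constPS a ≈ₚ constPS b)
constPS-equal? a b with a ℚP.≟ b
... | yes a≡b = just (constPS-cong a≡b)
... | no  _   = nothing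

open Algebra.Solver.Ring (CommutativeRing.rawRing ℚP.+-*-commutativeRing) (ACR.fromCommutativeRing PSring)
  constPS-morphism constPS-equal? using (solve; _:=_; _:+_; _:*_; _:-_; con)

constPS-* : ∀ a b → constPS (a *ℚ b) ≈ₚ constPS a ⊗ constPS b
constPS-* = ACR._-Raw-AlmostCommutative⟶_.*-homo constPS-morphism

constPS-+ : ∀ a b → constPS (a +ℚ b) ≈ₚ constPS a ⊕ constPS b
constPS-+ = ACR._-Raw-AlmostCommutative⟶_.+-homo constPS-morphism

ℕconst-* : ∀ a b → constPS (ℕ→ℚ (a * b)) ≈ₚ constPS (ℕ→ℚ a) ⊗ constPS (ℕ→ℚ b)
ℕconst-* a b = ≈-trans (constPS-cong (ℕ→ℚ-* a b)) (constPS-* (ℕ→ℚ a) (ℕ→ℚ b))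

open ClearingDenominators PSring using (cancel-unit; clear-denominators)

ℕconst-cancel : ∀ N → NonZero N → ∀ {U f g} → U ≈ₚ constPS (ℕ→ℚ N) → U ⊗ f ≈ₚ U ⊗ g → f ≈ₚ g
ℕconst-cancel (suc k) _ {U} U≈N = cancel-unit {u = U} {v = constPS (recip k)} (begin
  constPS (recip k) ⊗ U                    ≈⟨ ⊗-cong (≈-refl {constPS (recip k)}) U≈N ⟩
  constPS (recip k) ⊗ constPS (ℕ→ℚ (suc k)) ≈⟨ ≈-sym (constPS-* (recip k) (ℕ→ℚ (suc k))) ⟩
  constPS (recip k *ℚ ℕ→ℚ (suc k))          ≈⟨ constPS-cong (trans (ℚP.*-comm (recip k) _) (ℕ→ℚ-inverse k)) ⟩
  onePS                                    ∎)
  where open PS-Reasoning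

ℕscale-* : ∀ a b f → ℕ→ℚ (a * b) ·ₚ f ≈ₚ (constPS (ℕ→ℚ a) ⊗ constPS (ℕ→ℚ b)) ⊗ f
ℕscale-* a b f = ≈-trans (≈-sym (const⊗ (ℕ→ℚ (a * b)) f)) (⊗-cong (ℕconst-* a b) (≈-refl {f}))

T⊗-zero : ∀ f → (Tₚ ⊗ f) 0 ≡ 0ℚ
T⊗-zero f = ℚP.*-zeroˡ (f 0)

T⊗-suc : ∀ f k → (Tₚ ⊗ f) (suc k) ≡ f k
T⊗-suc f k = begin
  sumTo (suc k) (λ j → Tₚ j *ℚ f (suc k ∸ j))
    ≡⟨ sumTo-head k _ ⟩
  0ℚ *ℚ f (suc k) +ℚ sumTo k (λ j → Tₚ (suc j) *ℚ f (k ∸ j))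
    ≡⟨ cong₂ _+ℚ_ (ℚP.*-zeroˡ (f (suc k))) (only-first-term k) ⟩
  0ℚ +ℚ f k
    ≡⟨ ℚP.+-identityˡ (f k) ⟩
  f k ∎
  where
  open ≡-Reasoning
  only-first-term : ∀ k → sumTo k (λ j → Tₚ (suc j) *ℚ f (k ∸ j)) ≡ f k
  only-first-term zero    = ℚP.*-identityˡ (f 0)
  only-first-term (suc k) = begin
    sumTo (suc k) (λ j → Tₚ (suc j) *ℚ f (suc k ∸ j))
      ≡⟨ sumTo-head k _ ⟩
    1ℚ *ℚ f (suc k) +ℚ sumTo k (λ j → 0ℚ *ℚ f (k ∸ j))
      ≡⟨ cong₂ _+ℚ_ (ℚP.*-identityˡ (f (suc k))) (sumTo-zero k (λ j _ → ℚP.*-zeroˡ (f (k ∸ j)))) ⟩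
    f (suc k) +ℚ 0ℚ
      ≡⟨ ℚP.+-identityʳ (f (suc k)) ⟩
    f (suc k) ∎

T-cancel : ∀ {f g} → Tₚ ⊗ f ≈ₚ Tₚ ⊗ g → f ≈ₚ g
T-cancel {f} {g} Tf≈Tg k = trans (sym (T⊗-suc f k)) (trans (Tf≈Tg (suc k)) (T⊗-suc g k))

^ℚ-+ : ∀ b i j → b ^ℚ (i ℕ.+ j) ≡ (b ^ℚ i) *ℚ (b ^ℚ j)
^ℚ-+ b zero    j = sym (ℚP.*-identityˡ _)
^ℚ-+ b (suc i) j = trans (cong (b *ℚ_) (^ℚ-+ b i j)) (sym (ℚP.*-assoc b _ _))

subst-cong : ∀ c {f g} → f ≈ₚ g → substScale c f ≈ₚ substScale c g
subst-cong c f≈g k = cong ((c ^ℚ k) *ℚ_) (f≈g k)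

subst-⊗ : ∀ c f g → substScale c (f ⊗ g) ≈ₚ substScale c f ⊗ substScale c g
subst-⊗ c f g k = trans (sym (sumTo-*ˡ k (c ^ℚ k) _)) (sumTo-cong k λ j j≤k →
  trans (cong (λ i → (c ^ℚ i) *ℚ (f j *ℚ g (k ∸ j))) (sym (ℕP.m+[n∸m]≡n j≤k)))
  (trans (cong (_*ℚ (f j *ℚ g (k ∸ j))) (^ℚ-+ c j (k ∸ j)))
         (interchange (c ^ℚ j) (c ^ℚ (k ∸ j)) (f j) (g (k ∸ j)))))
  where
  interchange : ∀ a b x y → (a *ℚ b) *ℚ (x *ℚ y) ≡ (a *ℚ x) *ℚ (b *ℚ y)
  interchange = solve-∀ ℚring

subst-⊖ : ∀ c f g → substScale c (f ⊖ g) ≈ₚ substScale c f ⊖ substScale c g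
subst-⊖ c f g k = distrib (c ^ℚ k) (f k) (g k)
  where
  distrib : ∀ a x y → a *ℚ (x -ℚ y) ≡ a *ℚ x -ℚ a *ℚ y
  distrib = solve-∀ ℚring

subst-one : ∀ c → substScale c onePS ≈ₚ onePS
subst-one c zero    = ℚP.*-identityˡ 1ℚ
subst-one c (suc k) = ℚP.*-zeroʳ (c ^ℚ suc k)

subst-T : ∀ c → substScale c Tₚ ≈ₚ c ·ₚ Tₚ
subst-T c zero          = trans (ℚP.*-zeroʳ 1ℚ) (sym (ℚP.*-zeroʳ c))
subst-T c (suc zero)    = cong (_*ℚ 1ℚ) (ℚP.*-identityʳ c)
subst-T c (suc (suc k)) = trans (ℚP.*-zeroʳ (c ^ℚ suc (suc k))) (sym (ℚP.*-zeroʳ c))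

if-true : ∀ {P : Set} {A : Set} (d : Dec P) {x y : A} → P → (if ⌊ d ⌋ then x else y) ≡ x
if-true (yes _) _ = refl
if-true (no ¬p) p = ⊥-elim (¬p p)

if-false : ∀ {P : Set} {A : Set} (d : Dec P) {x y : A} → ¬ P → (if ⌊ d ⌋ then x else y) ≡ y
if-false (yes p) ¬p = ⊥-elim (¬p p)
if-false (no _)  _  = refl

invAux-stable : ∀ f k i → i ≤ k → invAux f k i ≡ inv1 f i
invAux-stable f k i i≤k with ℕP.m≤n⇒m<n∨m≡n i≤k
... | inj₂ refl = refl
invAux-stable f (suc k) i _ | inj₁ (s≤s i≤k) =
  trans (if-true (i ℕ.≤? k) i≤k) (invAux-stable f k i i≤k)

inv1-suc : ∀ f k → inv1 f (suc k) ≡ -ℚ sumTo k (λ j → f (suc j) *ℚ inv1 f (k ∸ j))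
inv1-suc f k = trans (if-false (suc k ℕ.≤? k) (ℕP.<-irrefl refl))
  (cong -ℚ_ (sumTo-cong k (λ j _ → cong (f (suc j) *ℚ_) (invAux-stable f k (k ∸ j) (ℕP.m∸n≤m k j)))))

-- Coefficient k+1 of f · inv1 f is  f(0)·inv1 f (k+1) + Σ_j f(j+1) inv1 f (k-j),  which the
-- recursion defining inv1 makes vanish.
inv1-inverse : ∀ f → f 0 ≡ 1ℚ → f ⊗ inv1 f ≈ₚ onePS
inv1-inverse f f0≡1 zero    = trans (cong (_*ℚ 1ℚ) f0≡1) (ℚP.*-identityˡ 1ℚ)
inv1-inverse f f0≡1 (suc k) = trans (sumTo-head k _)
  (trans (cong (_+ℚ tail) (cong₂ _*ℚ_ f0≡1 (inv1-suc f k)))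
         (trans (cong (_+ℚ tail) (ℚP.*-identityˡ (-ℚ tail))) (ℚP.+-inverseˡ tail)))
  where
  tail : ℚ
  tail = sumTo k (λ j → f (suc j) *ℚ inv1 f (k ∸ j))

T⊗expM1overT : Tₚ ⊗ expM1overT ≈ₚ expT ⊖ onePS
T⊗expM1overT zero    = refl
T⊗expM1overT (suc k) = trans (T⊗-suc expM1overT k) (sym (ℚP.+-identityʳ (invFact (suc k))))

-- B (e^T - 1) = B · T · (e^T - 1)/T = T.
B-defining : Bₚ ⊗ (expT ⊖ onePS) ≈ₚ Tₚ
B-defining = ≈-trans (⊗-cong (≈-refl {Bₚ}) (≈-sym T⊗expM1overT))
  (≈-trans (exchange Bₚ Tₚ expM1overT)
  (≈-trans (⊗-cong (≈-refl {Tₚ}) (≈-trans (⊗-comm Bₚ expM1overT) (inv1-inverse expM1overT refl)))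
           (⊗-identityʳ Tₚ)))
  where
  exchange : ∀ a b d → a ⊗ (b ⊗ d) ≈ₚ b ⊗ (a ⊗ d)
  exchange = solve 3 (λ a b d → (a :* (b :* d)) := (b :* (a :* d))) ≈-refl

B-scaled : ∀ c → substScale c Bₚ ⊗ (substScale c expT ⊖ onePS) ≈ₚ c ·ₚ Tₚ
B-scaled c = ≈-trans (⊗-cong (≈-refl {substScale c Bₚ}) substituted-factor)
  (≈-trans (≈-sym (subst-⊗ c Bₚ (expT ⊖ onePS)))
  (≈-trans (subst-cong c B-defining) (subst-T c)))
  where
  substituted-factor : substScale c expT ⊖ onePS ≈ₚ substScale c (expT ⊖ onePS)
  substituted-factor k =
    sym (trans (subst-⊖ c expT onePS k) (cong (λ z → substScale c expT k -ℚ z) (subst-one c k)))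

-- The formal derivative.  Exponentials are characterised by a differential equation, which
-- yields (e^T)^k = e^{kT}.
D : PS → PS
D f k = ℕ→ℚ (suc k) *ℚ f (suc k)

-- Leibniz rule, from  (k+1) = j + (k+1-j)  inside the Cauchy product.
D-⊗ : ∀ f g → D (f ⊗ g) ≈ₚ (D f ⊗ g) ⊕ (f ⊗ D g)
D-⊗ f g k = begin
  N *ℚ sumTo (suc k) (λ j → f j *ℚ g (suc k ∸ j))
    ≡⟨ sym (sumTo-*ˡ (suc k) N _) ⟩
  sumTo (suc k) (λ j → N *ℚ (f j *ℚ g (suc k ∸ j)))
    ≡⟨ sumTo-cong (suc k) split-weight ⟩
  sumTo (suc k) (λ j → left j +ℚ right j)
    ≡⟨ sumTo-+ (suc k) left right ⟩
  sumTo (suc k) left +ℚ sumTo (suc k) right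
    ≡⟨ cong₂ _+ℚ_ left-sum right-sum ⟩
  (D f ⊗ g) k +ℚ (f ⊗ D g) k ∎
  where
  open ≡-Reasoning
  N : ℚ
  N = ℕ→ℚ (suc k)
  left right : ℕ → ℚ
  left  j = ℕ→ℚ j *ℚ f j *ℚ g (suc k ∸ j)
  right j = ℕ→ℚ (suc k ∸ j) *ℚ f j *ℚ g (suc k ∸ j)
  distrib : ∀ a b x y → (a +ℚ b) *ℚ (x *ℚ y) ≡ a *ℚ x *ℚ y +ℚ b *ℚ x *ℚ y
  distrib = solve-∀ ℚring
  move-weight : ∀ b x y → b *ℚ x *ℚ y ≡ x *ℚ (b *ℚ y)
  move-weight = solve-∀ ℚring
  split-weight : ∀ j → j ≤ suc k → N *ℚ (f j *ℚ g (suc k ∸ j)) ≡ left j +ℚ right j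
  split-weight j j≤ = trans (cong (_*ℚ (f j *ℚ g (suc k ∸ j)))
      (trans (cong ℕ→ℚ (sym (ℕP.m+[n∸m]≡n j≤))) (ℕ→ℚ-+ j (suc k ∸ j))))
    (distrib (ℕ→ℚ j) (ℕ→ℚ (suc k ∸ j)) (f j) (g (suc k ∸ j)))
  -- the j = 0 term of the left sum vanishes; the rest is Σ (j+1) f_{j+1} g_{k-j}
  left-sum : sumTo (suc k) left ≡ (D f ⊗ g) k
  left-sum = trans (sumTo-head k left)
    (trans (cong (_+ℚ sumTo k (λ j → left (suc j)))
                 (trans (cong (_*ℚ g (suc k)) (ℚP.*-zeroˡ (f 0))) (ℚP.*-zeroˡ (g (suc k)))))
           (ℚP.+-identityˡ _))
  -- the j = k+1 term of the right sum vanishes; the rest is Σ f_j (k-j+1) g_{k-j+1}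
  right-sum : sumTo (suc k) right ≡ (f ⊗ D g) k
  right-sum = trans (cong (sumTo k right +ℚ_)
      (trans (cong (λ i → ℕ→ℚ i *ℚ f (suc k) *ℚ g i) (ℕP.n∸n≡0 (suc k)))
             (trans (cong (_*ℚ g 0) (ℚP.*-zeroˡ (f (suc k)))) (ℚP.*-zeroˡ (g 0)))))
    (trans (ℚP.+-identityʳ (sumTo k right)) (sumTo-cong k (λ j j≤k →
      trans (cong (λ i → ℕ→ℚ i *ℚ f j *ℚ g i) (ℕP.+-∸-assoc 1 j≤k))
            (move-weight (ℕ→ℚ (suc (k ∸ j))) (f j) (g (suc (k ∸ j)))))))

exp-unique : ∀ c h → h 0 ≡ 1ℚ → D h ≈ₚ c ·ₚ h → h ≈ₚ substScale c expT
exp-unique c h h0≡1 h′≡ch zero    = h0≡1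
exp-unique c h h0≡1 h′≡ch (suc k) = begin
  h (suc k)                                     ≡⟨ sym (ℚP.*-identityˡ _) ⟩
  1ℚ *ℚ h (suc k)                               ≡⟨ cong (_*ℚ h (suc k)) (sym (ℕ→ℚ-inverse k)) ⟩
  (ℕ→ℚ (suc k) *ℚ recip k) *ℚ h (suc k)         ≡⟨ regroup (recip k) (ℕ→ℚ (suc k)) (h (suc k)) ⟩
  recip k *ℚ (ℕ→ℚ (suc k) *ℚ h (suc k))         ≡⟨ cong (recip k *ℚ_) (h′≡ch k) ⟩
  recip k *ℚ (c *ℚ h k)                         ≡⟨ cong (λ z → recip k *ℚ (c *ℚ z)) (exp-unique c h h0≡1 h′≡ch k) ⟩
  recip k *ℚ (c *ℚ ((c ^ℚ k) *ℚ invFact k))     ≡⟨ next-coefficient (recip k) c (c ^ℚ k) (invFact k) ⟩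
  substScale c expT (suc k) ∎
  where
  open ≡-Reasoning
  regroup : ∀ w N x → (N *ℚ w) *ℚ x ≡ w *ℚ (N *ℚ x)
  regroup = solve-∀ ℚring
  next-coefficient : ∀ w c p i → w *ℚ (c *ℚ (p *ℚ i)) ≡ (c *ℚ p) *ℚ (i *ℚ w)
  next-coefficient = solve-∀ ℚring

-- (e^{cT})' = c e^{cT}, coefficientwise  (k+1)·c^{k+1}/(k+1)! = c·c^k/k!.
D-exp : ∀ c → D (substScale c expT) ≈ₚ c ·ₚ substScale c expT
D-exp c k = trans (regroup (ℕ→ℚ (suc k)) (recip k) c (c ^ℚ k) (invFact k))
  (trans (cong (_*ℚ (c *ℚ ((c ^ℚ k) *ℚ invFact k))) (ℕ→ℚ-inverse k)) (ℚP.*-identityˡ _))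
  where
  regroup : ∀ N w c p i → N *ℚ ((c *ℚ p) *ℚ (i *ℚ w)) ≡ (N *ℚ w) *ℚ (c *ℚ (p *ℚ i))
  regroup = solve-∀ ℚring

D-expT : D expT ≈ₚ expT
D-expT k = trans (regroup (ℕ→ℚ (suc k)) (recip k) (invFact k))
  (trans (cong (_*ℚ invFact k) (ℕ→ℚ-inverse k)) (ℚP.*-identityˡ _))
  where
  regroup : ∀ N w i → N *ℚ (i *ℚ w) ≡ (N *ℚ w) *ℚ i
  regroup = solve-∀ ℚring

⊗-·ʳ : ∀ c f g → f ⊗ (c ·ₚ g) ≈ₚ c ·ₚ (f ⊗ g)
⊗-·ʳ c f g k = trans (sumTo-cong k (λ j _ → exchange (f j) c (g (k ∸ j)))) (sumTo-*ˡ k c _)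
  where
  exchange : ∀ a c x → a *ℚ (c *ℚ x) ≡ c *ℚ (a *ℚ x)
  exchange = solve-∀ ℚring

-- e^T e^{cT} = e^{(1+c)T}: the product has constant term 1 and satisfies h' = (1+c) h.
exp-mul : ∀ c → expT ⊗ substScale c expT ≈ₚ substScale (1ℚ +ℚ c) expT
exp-mul c = exp-unique (1ℚ +ℚ c) (expT ⊗ E) refl (begin
  D (expT ⊗ E)                        ≈⟨ D-⊗ expT E ⟩
  D expT ⊗ E ⊕ expT ⊗ D E             ≈⟨ ⊕-cong (⊗-cong D-expT (≈-refl {E})) (⊗-cong (≈-refl {expT}) (D-exp c)) ⟩
  expT ⊗ E ⊕ expT ⊗ (c ·ₚ E)          ≈⟨ ⊕-cong (≈-refl {expT ⊗ E}) (⊗-·ʳ c expT E) ⟩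
  expT ⊗ E ⊕ c ·ₚ (expT ⊗ E)          ≈⟨ (λ k → collect ((expT ⊗ E) k) c) ⟩
  (1ℚ +ℚ c) ·ₚ (expT ⊗ E)             ∎)
  where
  open PS-Reasoning
  E : PS
  E = substScale c expT
  collect : ∀ x c → x +ℚ c *ℚ x ≡ (1ℚ +ℚ c) *ℚ x
  collect = solve-∀ ℚring

exp-pow : ∀ k → powPS expT k ≈ₚ substScale (ℕ→ℚ k) expT
exp-pow zero    zero    = refl
exp-pow zero    (suc j) = sym (trans (ℚP.*-assoc 0ℚ (0ℚ ^ℚ j) (expT (suc j))) (ℚP.*-zeroˡ ((0ℚ ^ℚ j) *ℚ expT (suc j))))
exp-pow (suc k) = ≈-trans (⊗-cong (≈-refl {expT}) (exp-pow k))
  (≈-trans (exp-mul (ℕ→ℚ k)) (λ i → cong (λ c → substScale c expT i) (sym (ℕ→ℚ-+ 1 k))))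

-- Polynomials: Horner evaluation at a power series is a ring homomorphism, and it only
-- depends on the coefficient sequence.  Hence polynomial identities can be evaluated at X = e^{ℓT}.
addPoly : Poly → Poly → Poly
addPoly []       b        = b
addPoly (x ∷ a)  []       = x ∷ a
addPoly (x ∷ a)  (y ∷ b)  = (x +ℚ y) ∷ addPoly a b

scalePoly : ℚ → Poly → Poly
scalePoly c []      = []
scalePoly c (x ∷ a) = (c *ℚ x) ∷ scalePoly c a

mulPoly : Poly → Poly → Poly
mulPoly []      b = []
mulPoly (x ∷ a) b = addPoly (scalePoly x b) (0ℚ ∷ mulPoly a b)

constPS-zero : constPS 0ℚ ≈ₚ zeroPS
constPS-zero zero    = refl
constPS-zero (suc k) = refl

module _ (s : PS) where

  evalPS-add : ∀ a b → evalPS (addPoly a b) s ≈ₚ evalPS a s ⊕ evalPS b s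
  evalPS-add []      b       k = sym (trans (cong (_+ℚ evalPS b s k) (constPS-zero k)) (ℚP.+-identityˡ _))
  evalPS-add (x ∷ a) []      k = sym (trans (cong (evalPS (x ∷ a) s k +ℚ_) (constPS-zero k)) (ℚP.+-identityʳ _))
  evalPS-add (x ∷ a) (y ∷ b) =
    ≈-trans (⊕-cong (constPS-+ x y) (⊗-cong (≈-refl {s}) (evalPS-add a b)))
            (regroup (constPS x) (constPS y) s (evalPS a s) (evalPS b s))
    where
    regroup : ∀ X Y S U V → (X ⊕ Y) ⊕ S ⊗ (U ⊕ V) ≈ₚ (X ⊕ S ⊗ U) ⊕ (Y ⊕ S ⊗ V)
    regroup = solve 5 (λ X Y S U V → ((X :+ Y) :+ S :* (U :+ V)) := ((X :+ S :* U) :+ (Y :+ S :* V))) ≈-refl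

  evalPS-scale : ∀ c a → evalPS (scalePoly c a) s ≈ₚ constPS c ⊗ evalPS a s
  evalPS-scale c [] = ≈-trans (constPS-cong (sym (ℚP.*-zeroʳ c))) (constPS-* c 0ℚ)
  evalPS-scale c (x ∷ a) =
    ≈-trans (⊕-cong (constPS-* c x) (⊗-cong (≈-refl {s}) (evalPS-scale c a)))
            (factor (constPS c) (constPS x) s (evalPS a s))
    where
    factor : ∀ C X S U → C ⊗ X ⊕ S ⊗ (C ⊗ U) ≈ₚ C ⊗ (X ⊕ S ⊗ U)
    factor = solve 4 (λ C X S U → (C :* X :+ S :* (C :* U)) := (C :* (X :+ S :* U))) ≈-refl

  evalPS-mul : ∀ a b → evalPS (mulPoly a b) s ≈ₚ evalPS a s ⊗ evalPS b s
  evalPS-mul []      b = ≈-sym (≈-trans (const⊗ 0ℚ (evalPS b s))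
    (λ k → trans (ℚP.*-zeroˡ (evalPS b s k)) (sym (constPS-zero k))))
  evalPS-mul (x ∷ a) b =
    ≈-trans (evalPS-add (scalePoly x b) (0ℚ ∷ mulPoly a b))
    (≈-trans (⊕-cong (evalPS-scale x b) (⊕-cong (≈-refl {constPS 0ℚ}) (⊗-cong (≈-refl {s}) (evalPS-mul a b))))
             (factor (constPS x) s (evalPS a s) (evalPS b s)))
    where
    factor : ∀ X S U V → X ⊗ V ⊕ (constPS 0ℚ ⊕ S ⊗ (U ⊗ V)) ≈ₚ (X ⊕ S ⊗ U) ⊗ V
    factor = solve 4 (λ X S U V → (X :* V :+ (con 0ℚ :+ S :* (U :* V))) := ((X :+ S :* U) :* V)) ≈-refl

  evalPS-zero : ∀ b → polyCoeff b ≈ₚ zeroPS → evalPS b s ≈ₚ constPS 0ℚ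
  evalPS-zero []      _    = ≈-refl
  evalPS-zero (y ∷ b) b≈0 =
    ≈-trans (⊕-cong (constPS-cong (b≈0 0)) (⊗-cong (≈-refl {s}) (evalPS-zero b (λ k → b≈0 (suc k)))))
            (vanish s)
    where
    vanish : ∀ S → constPS 0ℚ ⊕ S ⊗ constPS 0ℚ ≈ₚ constPS 0ℚ
    vanish = solve 1 (λ S → (con 0ℚ :+ S :* con 0ℚ) := con 0ℚ) ≈-refl

  evalPS-coeff : ∀ a b → polyCoeff a ≈ₚ polyCoeff b → evalPS a s ≈ₚ evalPS b s
  evalPS-coeff []      b       a≈b = ≈-sym (evalPS-zero b (λ k → sym (a≈b k)))
  evalPS-coeff (x ∷ a) []      a≈b = evalPS-zero (x ∷ a) a≈b
  evalPS-coeff (x ∷ a) (y ∷ b) a≈b =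
    ⊕-cong (constPS-cong (a≈b 0)) (⊗-cong (≈-refl {s}) (evalPS-coeff a b (λ k → a≈b (suc k))))

evalPS-T : ∀ a → polyCoeff a ≈ₚ evalPS a Tₚ
evalPS-T []       = ≈-sym constPS-zero
evalPS-T (c ∷ cs) zero    = sym (trans (cong (c +ℚ_) (T⊗-zero (evalPS cs Tₚ))) (ℚP.+-identityʳ c))
evalPS-T (c ∷ cs) (suc k) = sym (trans (ℚP.+-identityˡ _) (trans (T⊗-suc (evalPS cs Tₚ) k) (sym (evalPS-T cs k))))

phiPoly : ℕ → Poly
phiPoly m = replicate m 1ℚ

xm1Poly : Poly
xm1Poly = -ℚ 1ℚ ∷ 1ℚ ∷ []

Φ-suc : ∀ m k → Φ (suc m) (suc k) ≡ Φ m k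
Φ-suc m k with k ℕ.<? m
... | yes k<m = if-true (suc k ℕ.<? suc m) (s≤s k<m)
... | no  k≮m = if-false (suc k ℕ.<? suc m) (λ k+1<m+1 → k≮m (ℕP.≤-pred k+1<m+1))

phiPoly-coeff : ∀ m → polyCoeff (phiPoly m) ≈ₚ Φ m
phiPoly-coeff zero    k       = sym (if-false (k ℕ.<? 0) {x = 1ℚ} {y = 0ℚ} (λ ()))
phiPoly-coeff (suc m) zero    = sym (if-true (0 ℕ.<? suc m) {x = 1ℚ} {y = 0ℚ} (s≤s z≤n))
phiPoly-coeff (suc m) (suc k) = trans (phiPoly-coeff m k) (sym (Φ-suc m k))

xm1Poly-coeff : polyCoeff xm1Poly ≈ₚ Xm1
xm1Poly-coeff zero          = refl
xm1Poly-coeff (suc zero)    = refl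
xm1Poly-coeff (suc (suc k)) = refl

evalPS-xm1 : ∀ X → evalPS xm1Poly X ≈ₚ X ⊖ onePS
evalPS-xm1 = solve 1 (λ X → (con (-ℚ 1ℚ) :+ X :* (con 1ℚ :+ X :* con 0ℚ)) := (X :- con 1ℚ)) ≈-refl

cyclotomic : ∀ X m → evalPS xm1Poly X ⊗ evalPS (phiPoly m) X ≈ₚ powPS X m ⊖ onePS
cyclotomic X zero    = vanish (evalPS xm1Poly X)
  where
  vanish : ∀ A → A ⊗ constPS 0ℚ ≈ₚ onePS ⊖ onePS
  vanish = solve 1 (λ A → (A :* con 0ℚ) := (con 1ℚ :- con 1ℚ)) ≈-refl
cyclotomic X (suc m) = ≈-trans (step A X (evalPS (phiPoly m) X))
  (≈-trans (⊕-cong (evalPS-xm1 X) (⊗-cong (≈-refl {X}) (cyclotomic X m))) (telescope X (powPS X m)))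
  where
  A : PS
  A = evalPS xm1Poly X
  step : ∀ A X P → A ⊗ (onePS ⊕ X ⊗ P) ≈ₚ A ⊕ X ⊗ (A ⊗ P)
  step = solve 3 (λ A X P → (A :* (con 1ℚ :+ X :* P)) := (A :+ X :* (A :* P))) ≈-refl
  telescope : ∀ X Q → (X ⊖ onePS) ⊕ X ⊗ (Q ⊖ onePS) ≈ₚ X ⊗ Q ⊖ onePS
  telescope = solve 2 (λ X Q → ((X :- con 1ℚ) :+ X :* (Q :- con 1ℚ)) := (X :* Q :- con 1ℚ)) ≈-refl

pfSeries : (C Φm Φn A Q P : PS) → PS
pfSeries C Φm Φn A Q P = Φm ⊗ Φn ⊕ C ⊗ (A ⊗ Φm ⊗ Q) ⊕ C ⊗ (A ⊗ Φn ⊗ P)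

pfSeries-cong : ∀ {C C′ Φm Φm′ Φn Φn′ A A′ Q Q′ P P′} → C ≈ₚ C′ → Φm ≈ₚ Φm′ → Φn ≈ₚ Φn′ →
  A ≈ₚ A′ → Q ≈ₚ Q′ → P ≈ₚ P′ → pfSeries C Φm Φn A Q P ≈ₚ pfSeries C′ Φm′ Φn′ A′ Q′ P′
pfSeries-cong C≈ Φm≈ Φn≈ A≈ Q≈ P≈ =
  ⊕-cong (⊕-cong (⊗-cong Φm≈ Φn≈) (⊗-cong C≈ (⊗-cong (⊗-cong A≈ Φm≈) Q≈)))
         (⊗-cong C≈ (⊗-cong (⊗-cong A≈ Φn≈) P≈))

pfTerm : ℚ → ℕ → Poly → Poly
pfTerm c k r = scalePoly c (mulPoly (mulPoly xm1Poly (phiPoly k)) r)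

pfPoly : ℚ → ℕ → ℕ → Poly → Poly → Poly
pfPoly c m n p q = addPoly (addPoly (mulPoly (phiPoly m) (phiPoly n)) (pfTerm c m q)) (pfTerm c n p)

evalPS-pfTerm : ∀ s c k r →
  evalPS (pfTerm c k r) s ≈ₚ constPS c ⊗ (evalPS xm1Poly s ⊗ evalPS (phiPoly k) s ⊗ evalPS r s)
evalPS-pfTerm s c k r = ≈-trans (evalPS-scale s c (mulPoly (mulPoly xm1Poly (phiPoly k)) r))
  (⊗-cong (≈-refl {constPS c}) (≈-trans (evalPS-mul s (mulPoly xm1Poly (phiPoly k)) r)
                                        (⊗-cong (evalPS-mul s xm1Poly (phiPoly k)) (≈-refl {evalPS r s}))))

evalPS-pfPoly : ∀ s c m n p q → evalPS (pfPoly c m n p q) s ≈ₚ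
  pfSeries (constPS c) (evalPS (phiPoly m) s) (evalPS (phiPoly n) s) (evalPS xm1Poly s) (evalPS q s) (evalPS p s)
evalPS-pfPoly s c m n p q =
  ≈-trans (evalPS-add s (addPoly ΦmΦn (pfTerm c m q)) (pfTerm c n p))
    (⊕-cong (≈-trans (evalPS-add s ΦmΦn (pfTerm c m q))
                     (⊕-cong (evalPS-mul s (phiPoly m) (phiPoly n)) (evalPS-pfTerm s c m q)))
            (evalPS-pfTerm s c n p))
  where
  ΦmΦn : Poly
  ΦmΦn = mulPoly (phiPoly m) (phiPoly n)

partialFrac-coeff : ∀ m n p q → PartialFrac m n p q →
  polyCoeff (ℕ→ℚ (m * n) ∷ []) ≈ₚ polyCoeff (pfPoly (ℕ→ℚ (m * n)) m n p q)
partialFrac-coeff m n p q pf = begin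
  polyCoeff (c ∷ [])  ≈⟨ constant-coeff ⟩
  constPS c           ≈⟨ pf ⟩
  Φ m ⊗ Φ n ⊕ c ·ₚ (Xm1 ⊗ Φ m ⊗ polyCoeff q) ⊕ c ·ₚ (Xm1 ⊗ Φ n ⊗ polyCoeff p)
    ≈⟨ ⊕-cong (⊕-cong (≈-refl {Φ m ⊗ Φ n}) (≈-sym (const⊗ c (Xm1 ⊗ Φ m ⊗ polyCoeff q))))
              (≈-sym (const⊗ c (Xm1 ⊗ Φ n ⊗ polyCoeff p))) ⟩
  pfSeries (constPS c) (Φ m) (Φ n) Xm1 (polyCoeff q) (polyCoeff p)
    ≈⟨ pfSeries-cong (≈-refl {constPS c}) (at-T (phiPoly m) (phiPoly-coeff m)) (at-T (phiPoly n) (phiPoly-coeff n))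
                     (at-T xm1Poly xm1Poly-coeff) (evalPS-T q) (evalPS-T p) ⟩
  pfSeries (constPS c) (evalPS (phiPoly m) Tₚ) (evalPS (phiPoly n) Tₚ) (evalPS xm1Poly Tₚ) (evalPS q Tₚ) (evalPS p Tₚ)
    ≈⟨ ≈-sym (evalPS-pfPoly Tₚ c m n p q) ⟩
  evalPS (pfPoly c m n p q) Tₚ  ≈⟨ ≈-sym (evalPS-T (pfPoly c m n p q)) ⟩
  polyCoeff (pfPoly c m n p q) ∎
  where
  open PS-Reasoning
  c : ℚ
  c = ℕ→ℚ (m * n)
  constant-coeff : polyCoeff (c ∷ []) ≈ₚ constPS c
  constant-coeff zero    = refl
  constant-coeff (suc k) = refl
  at-T : ∀ a {f} → polyCoeff a ≈ₚ f → f ≈ₚ evalPS a Tₚ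
  at-T a a≈f = ≈-trans (≈-sym a≈f) (evalPS-T a)

partialFrac-at : ∀ m n p q → PartialFrac m n p q → ∀ X →
  let μν = constPS (ℕ→ℚ m) ⊗ constPS (ℕ→ℚ n) in
  μν ≈ₚ pfSeries μν (evalPS (phiPoly m) X) (evalPS (phiPoly n) X) (evalPS xm1Poly X) (evalPS q X) (evalPS p X)
partialFrac-at m n p q pf X = begin
  μν                           ≈⟨ ≈-sym (ℕconst-* m n) ⟩
  constPS c                    ≈⟨ ≈-sym (constant-value (constPS c) X) ⟩
  evalPS (c ∷ []) X            ≈⟨ evalPS-coeff X (c ∷ []) (pfPoly c m n p q) (partialFrac-coeff m n p q pf) ⟩
  evalPS (pfPoly c m n p q) X  ≈⟨ evalPS-pfPoly X c m n p q ⟩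
  atX (constPS c)              ≈⟨ pfSeries-cong (ℕconst-* m n)
                                    (≈-refl {evalPS (phiPoly m) X}) (≈-refl {evalPS (phiPoly n) X})
                                    (≈-refl {evalPS xm1Poly X}) (≈-refl {evalPS q X}) (≈-refl {evalPS p X}) ⟩
  atX μν                       ∎
  where
  open PS-Reasoning
  c : ℚ
  c = ℕ→ℚ (m * n)
  μν : PS
  μν = constPS (ℕ→ℚ m) ⊗ constPS (ℕ→ℚ n)
  atX : PS → PS
  atX C = pfSeries C (evalPS (phiPoly m) X) (evalPS (phiPoly n) X) (evalPS xm1Poly X) (evalPS q X) (evalPS p X)
  constant-value : ∀ C X → C ⊕ X ⊗ constPS 0ℚ ≈ₚ C
  constant-value = solve 2 (λ C X → (C :+ X :* con 0ℚ) := C) ≈-refl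

-- powPS is the exponentiation of the ring ℚ[[T]], so the library's exponent laws apply to it.
open Algebra.Properties.Semiring.Exp (CommutativeRing.semiring PSring) using (_^_; ^-congˡ; ^-congʳ; ^-assocʳ)

powPS-^ : ∀ f k → powPS f k ≈ₚ f ^ k
powPS-^ f zero    = ≈-refl
powPS-^ f (suc k) = ⊗-cong (≈-refl {f}) (powPS-^ f k)

pow-pow : ∀ f a b → powPS (powPS f a) b ≈ₚ powPS f (b * a)
pow-pow f a b = begin
  powPS (powPS f a) b  ≈⟨ powPS-^ (powPS f a) b ⟩
  powPS f a ^ b        ≈⟨ ^-congˡ b (powPS-^ f a) ⟩
  (f ^ a) ^ b          ≈⟨ ^-assocʳ f a b ⟩
  f ^ (a * b)          ≈⟨ ^-congʳ f (ℕP.*-comm a b) ⟩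
  f ^ (b * a)          ≈⟨ ≈-sym (powPS-^ f (b * a)) ⟩
  powPS f (b * a)      ∎
  where open PS-Reasoning

minus-one-cong : ∀ {f g} → f ≈ₚ g → f ⊖ onePS ≈ₚ g ⊖ onePS
minus-one-cong f≈g k = cong (λ z → z -ℚ onePS k) (f≈g k)

B-xm1-at-exp : ∀ ℓ → substScale (ℕ→ℚ ℓ) Bₚ ⊗ evalPS xm1Poly (powPS expT ℓ) ≈ₚ constPS (ℕ→ℚ ℓ) ⊗ Tₚ
B-xm1-at-exp ℓ = begin
  substScale (ℕ→ℚ ℓ) Bₚ ⊗ evalPS xm1Poly (powPS expT ℓ)
    ≈⟨ ⊗-cong (≈-refl {substScale (ℕ→ℚ ℓ) Bₚ}) (≈-trans (evalPS-xm1 (powPS expT ℓ)) (minus-one-cong (exp-pow ℓ))) ⟩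
  substScale (ℕ→ℚ ℓ) Bₚ ⊗ (substScale (ℕ→ℚ ℓ) expT ⊖ onePS)
    ≈⟨ B-scaled (ℕ→ℚ ℓ) ⟩
  ℕ→ℚ ℓ ·ₚ Tₚ
    ≈⟨ ≈-sym (const⊗ (ℕ→ℚ ℓ) Tₚ) ⟩
  constPS (ℕ→ℚ ℓ) ⊗ Tₚ ∎
  where open PS-Reasoning

B-cyclotomic-at-exp : ∀ ℓ k → let X = powPS expT ℓ in
  substScale (ℕ→ℚ (k * ℓ)) Bₚ ⊗ (evalPS xm1Poly X ⊗ evalPS (phiPoly k) X)
    ≈ₚ (constPS (ℕ→ℚ k) ⊗ constPS (ℕ→ℚ ℓ)) ⊗ Tₚ
B-cyclotomic-at-exp ℓ k = begin
  substScale (ℕ→ℚ (k * ℓ)) Bₚ ⊗ (evalPS xm1Poly X ⊗ evalPS (phiPoly k) X)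
    ≈⟨ ⊗-cong (≈-refl {substScale (ℕ→ℚ (k * ℓ)) Bₚ}) (≈-trans (cyclotomic X k) (minus-one-cong X^k≈e^kℓT)) ⟩
  substScale (ℕ→ℚ (k * ℓ)) Bₚ ⊗ (substScale (ℕ→ℚ (k * ℓ)) expT ⊖ onePS)
    ≈⟨ B-scaled (ℕ→ℚ (k * ℓ)) ⟩
  ℕ→ℚ (k * ℓ) ·ₚ Tₚ
    ≈⟨ ℕscale-* k ℓ Tₚ ⟩
  (constPS (ℕ→ℚ k) ⊗ constPS (ℕ→ℚ ℓ)) ⊗ Tₚ ∎
  where
  open PS-Reasoning
  X : PS
  X = powPS expT ℓ
  X^k≈e^kℓT : powPS X k ≈ₚ substScale (ℕ→ℚ (k * ℓ)) expT
  X^k≈e^kℓT = ≈-trans (pow-pow expT ℓ k) (exp-pow (k * ℓ))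

mainTheorem5 : (m n : ℕ) → NonZero m → NonZero n → m ≢ n →
               (ℓ m₀ n₀ : ℕ) → ℓ ≡ gcd m n → m ≡ m₀ * ℓ → n ≡ n₀ * ℓ →
               (p q : Poly) → length p ≤ m₀ ∸ 1 → length q ≤ n₀ ∸ 1 →
               PartialFrac m₀ n₀ p q →
               substScale (ℕ→ℚ m) Bₚ ⊗ substScale (ℕ→ℚ n) Bₚ
                 ≈ₚ powPS (substScale (ℕ→ℚ ℓ) Bₚ) 2
                    ⊕ ℕ→ℚ m ·ₚ (Tₚ ⊗ substScale (ℕ→ℚ n) Bₚ ⊗ evalPS q (powPS expT ℓ))
                    ⊕ ℕ→ℚ n ·ₚ (Tₚ ⊗ substScale (ℕ→ℚ m) Bₚ ⊗ evalPS p (powPS expT ℓ))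
mainTheorem5 m n m≢0 n≢0 _ ℓ m₀ n₀ _ refl refl p q _ _ pf =
  ≈-trans (T-cancel (T-cancel (ℕconst-cancel (m * n) (ℕP.m*n≢0 m n {{m≢0}} {{n≢0}}) mn≈μℓνℓ cleared)))
          (≈-sym rhs-regrouped)
  where
  X Bm Bn Bl μℓ νℓ : PS
  X  = powPS expT ℓ
  Bm = substScale (ℕ→ℚ m) Bₚ
  Bn = substScale (ℕ→ℚ n) Bₚ
  Bl = substScale (ℕ→ℚ ℓ) Bₚ
  μℓ = constPS (ℕ→ℚ m₀) ⊗ constPS (ℕ→ℚ ℓ)
  νℓ = constPS (ℕ→ℚ n₀) ⊗ constPS (ℕ→ℚ ℓ)
  -- the theorem multiplied by mn T²
  cleared : (μℓ ⊗ νℓ) ⊗ (Tₚ ⊗ (Tₚ ⊗ (Bm ⊗ Bn)))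
            ≈ₚ (μℓ ⊗ νℓ) ⊗ (Tₚ ⊗ (Tₚ ⊗ (Bl ⊗ Bl ⊕ μℓ ⊗ (Tₚ ⊗ Bn ⊗ evalPS q X) ⊕ νℓ ⊗ (Tₚ ⊗ Bm ⊗ evalPS p X))))
  cleared = clear-denominators
    {μ = constPS (ℕ→ℚ m₀)} {ν = constPS (ℕ→ℚ n₀)} {l = constPS (ℕ→ℚ ℓ)} {t = Tₚ} {bm = Bm} {bn = Bn} {bl = Bl}
    {a = evalPS xm1Poly X} {φm = evalPS (phiPoly m₀) X} {φn = evalPS (phiPoly n₀) X} {p = evalPS p X} {q = evalPS q X}
    (B-cyclotomic-at-exp ℓ m₀) (B-cyclotomic-at-exp ℓ n₀) (B-xm1-at-exp ℓ) (partialFrac-at m₀ n₀ p q pf X)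
  mn≈μℓνℓ : μℓ ⊗ νℓ ≈ₚ constPS (ℕ→ℚ (m * n))
  mn≈μℓνℓ = ≈-sym (≈-trans (ℕconst-* m n) (⊗-cong (ℕconst-* m₀ ℓ) (ℕconst-* n₀ ℓ)))
  rhs-regrouped : powPS Bl 2 ⊕ ℕ→ℚ m ·ₚ (Tₚ ⊗ Bn ⊗ evalPS q X) ⊕ ℕ→ℚ n ·ₚ (Tₚ ⊗ Bm ⊗ evalPS p X)
                  ≈ₚ Bl ⊗ Bl ⊕ μℓ ⊗ (Tₚ ⊗ Bn ⊗ evalPS q X) ⊕ νℓ ⊗ (Tₚ ⊗ Bm ⊗ evalPS p X)
  rhs-regrouped = ⊕-cong (⊕-cong (⊗-cong (≈-refl {Bl}) (⊗-identityʳ Bl)) (ℕscale-* m₀ ℓ _)) (ℕscale-* n₀ ℓ _)
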